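{- Let $G$ be a graph with a twin cover $M$, let $\mathcal{Q}'$ be the set of isolated cliques among the components of $G-M$, and let $\hat\ell=\sum_{Q\in\mathcal{Q}'}|Q|$. Then for every integer $\ell$, $(G,\ell)$ is a yes-instance of \textsc{Class Domination Coloring} if and only if $(G-\bigcup_{Q\in\mathcal{Q}'}V(Q),\ \ell-\hat\ell)$ is a yes-instance of \textsc{Class Domination Coloring}.
   Context: Graphs are finite and simple; $N_G[v]=N_G(v)\cup\{v\}$. A twin cover is $M\subseteq V(G)$ such that for every edge $uv$, $u\in M$ or $v\in M$ or $N_G[u]=N_G[v]$; then every component $Q$ of $G-M$ is a clique whose vertices share the same closed neighborhood $N_G[Q]$, and $Q$ is called isolated if $N_G[Q]\cap M=\emptyset$. A CD coloring of $G$ is a proper coloring in which every color class is dominated by some vertex (contained in $N_G[v]$ for some $v$). \textsc{Class Domination Coloring}: given $(G,\ell)$, decide whether $G$ has a CD coloring with at most $\ell$ colors. -}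

module Defs where

open import Data.Bool using (Bool; true; false; T; not)
open import Data.Nat using (ℕ)
open import Data.Integer using (ℤ; +_; _≤_)
open import Data.Fin using (Fin)
open import Data.List using (length; filterᵇ; allFin)
open import Data.Product using (Σ; ∃; _×_; proj₁)
open import Data.Sum using (_⊎_)
open import Relation.Binary.PropositionalEquality using (_≡_; _≢_)
open import Function.Bundles using (_⇔_)
open import Relation.Nullary using (¬_)

record Graph (V : Set) : Set where
  field
    adj   : V → V → Bool
    sym   : ∀ u v → adj u v ≡ adj v u
    irrefl : ∀ v → adj v v ≡ false
open Graph public

InN : {V : Set} → Graph V → V → V → Set
InN G v w = (v ≡ w) ⊎ (adj G v w ≡ true)

SameClosedNbhd : {V : Set} → Graph V → V → V → Set
SameClosedNbhd G u v = ∀ w → (InN G u w ⇔ InN G v w)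

induced : {V : Set} → Graph V → (keep : V → Bool) → Graph (Σ V (λ v → T (keep v)))
induced G keep = record
  { adj = λ u v → adj G (proj₁ u) (proj₁ v)
  ; sym = λ u v → sym G (proj₁ u) (proj₁ v)
  ; irrefl = λ v → irrefl G (proj₁ v) }

_minus_ : {V : Set} → Graph V → (X : V → Bool) → Graph (Σ V (λ v → T (not (X v))))
G minus X = induced G (λ v → not (X v))

record CDColoring {V : Set} (G : Graph V) (k : ℕ) : Set where
  field
    color     : V → Fin k
    proper    : ∀ u v → adj G u v ≡ true → color u ≢ color v
    dominated : ∀ (i : Fin k) → (∃ λ v → color v ≡ i) →
                ∃ λ w → ∀ v → color v ≡ i → InN G w v

YesCDC : {V : Set} → Graph V → ℤ → Set
YesCDC G ℓ = ∃ λ (k : ℕ) → (+ k ≤ ℓ) × CDColoring G k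

IsTwinCover : {V : Set} → Graph V → (V → Bool) → Set
IsTwinCover G M = ∀ u v → adj G u v ≡ true →
  (M u ≡ true) ⊎ (M v ≡ true) ⊎ SameClosedNbhd G u v

-- Reach G M u v : u and v lie in the same connected component of G - M
-- (both outside M, joined by a path in G - M).
data Reach {V : Set} (G : Graph V) (M : V → Bool) : V → V → Set where
  here : ∀ {v} → M v ≡ false → Reach G M v v
  step : ∀ {u w v} → M u ≡ false → adj G u w ≡ true → Reach G M w v → Reach G M u v

-- v lies in an isolated component Q of G - M, i.e. v ∉ M and
-- N_G[Q] ∩ M = ∅ for the component Q of G - M containing v.
InIsolatedComponent : {V : Set} → Graph V → (V → Bool) → V → Set
InIsolatedComponent G M v =
  (M v ≡ false) × (∀ u x → Reach G M v u → InN G u x → M x ≡ false)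

count : {n : ℕ} → (Fin n → Bool) → ℕ
count {n} X = length (filterᵇ X (allFin n))

{-# OPTIONS --safe #-}
module Submission where

-- The vertices X of the isolated cliques are closed under closed neighbourhoods,
-- and adjacent vertices of X are true twins.  So in a CD coloring of G the class
-- of a vertex u ∈ X is dominated by u itself or by a twin of u, hence lies in
-- N[u], and being independent it is {u}.  Deleting X therefore releases |X|
-- colors used nowhere else; conversely a CD coloring of G - X extends to G by
-- giving every vertex of X a fresh color of its own.

open import Defs
open import Data.Bool using (Bool; true; false; T; not; T?) renaming (_≟_ to _≟ᵇ_)
open import Data.Bool.Properties using (T-≡; T-not-≡; T-irrelevant)
open import Data.Nat using (ℕ; suc; _+_) renaming (_≤_ to _≤ℕ_)
open import Data.Nat.Properties using (+-suc; +-monoʳ-≤; ≤-trans; ≤-reflexive)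
open import Data.Integer using (ℤ; +_; _-_; -_; +≤+) renaming (_+_ to _+ℤ_; _≤_ to _≤ℤ_)
open import Data.Integer.Properties using (+-0-abelianGroup; pos-+; +-monoˡ-≤; module ≤-Reasoning) renaming (≤-trans to ≤ℤ-trans)
open import Algebra.Properties.AbelianGroup +-0-abelianGroup using (//-rightDividesˡ; //-rightDividesʳ)
open import Data.Fin using (Fin; zero; suc; join; splitAt) renaming (_≟_ to _≟ᶠ_)
open import Data.Fin.Properties using (injective⇒≤; any?; splitAt-join)
open import Data.List using (List; []; _∷_; length; filterᵇ; allFin; lookup)
open import Data.List.Properties using (length-tabulate)
open import Data.List.Membership.Propositional using (_∈_)
open import Data.List.Membership.Propositional.Properties using (∈-filter⁺; ∈-filter⁻; ∈-allFin; ∈-lookup)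
open import Data.List.Relation.Unary.All as All using ()
open import Data.List.Relation.Unary.Any using (index)
open import Data.List.Relation.Unary.Any.Properties using (lookup-index)
open import Data.List.Relation.Unary.Unique.Propositional using (Unique; _∷_)
open import Data.List.Relation.Unary.Unique.Propositional.Properties using (filter⁺; allFin⁺)
open import Data.Product using (Σ; ∃; _×_; _,_; proj₁; proj₂)
open import Data.Sum using (_⊎_; inj₁; inj₂; [_,_]′)
open import Data.Sum.Properties using (inj₁-injective; inj₂-injective)
open import Data.Unit using (tt)
open import Function using (_∘_)
open import Function.Bundles using (_⇔_; mk⇔; Equivalence)
open import Relation.Binary.PropositionalEquality as ≡ using (_≡_; _≢_; refl; trans; cong; module ≡-Reasoning)
open import Relation.Nullary using (Dec; does; ¬?; contradiction)
open import Relation.Nullary.Decidable using (dec-true; _×-dec_)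

length-filterᵇ-complement : ∀ {A : Set} (p : A → Bool) (xs : List A) →
  length (filterᵇ p xs) + length (filterᵇ (not ∘ p) xs) ≡ length xs
length-filterᵇ-complement p [] = refl
length-filterᵇ-complement p (x ∷ xs) with p x
... | true  = cong suc (length-filterᵇ-complement p xs)
... | false = trans (+-suc _ _) (cong suc (length-filterᵇ-complement p xs))

count-complement : ∀ {n} (p : Fin n → Bool) → count p + count (not ∘ p) ≡ n
count-complement {n} p = trans (length-filterᵇ-complement p (allFin n)) (length-tabulate _)

lookup-injective : ∀ {A : Set} {xs : List A} → Unique xs →
  ∀ {i j} → lookup xs i ≡ lookup xs j → i ≡ j
lookup-injective (_    ∷ _) {zero}  {zero}  _ = refl
lookup-injective (x∉xs ∷ _) {zero}  {suc j} e = contradiction e (All.lookup x∉xs (∈-lookup j))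
lookup-injective (x∉xs ∷ _) {suc i} {zero}  e = contradiction (≡.sym e) (All.lookup x∉xs (∈-lookup i))
lookup-injective (_    ∷ u) {suc i} {suc j} e = cong suc (lookup-injective u e)

module _ {n : ℕ} (p : Fin n → Bool) where

  private
    members : List (Fin n)
    members = filterᵇ p (allFin n)

    ∈-members : ∀ {v} → p v ≡ true → v ∈ members
    ∈-members pv = ∈-filter⁺ (T? ∘ p) (∈-allFin _) (Equivalence.from T-≡ pv)

  rank : ∀ v → p v ≡ true → Fin (count p)
  rank v pv = index (∈-members pv)

  rank-injective : ∀ {u v} (pu : p u ≡ true) (pv : p v ≡ true) → rank u pu ≡ rank v pv → u ≡ v
  rank-injective {u} {v} pu pv e = begin
    u                            ≡⟨ lookup-index (∈-members pu) ⟩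
    lookup members (rank u pu)   ≡⟨ cong (lookup members) e ⟩
    lookup members (rank v pv)   ≡⟨ lookup-index (∈-members pv) ⟨
    v                            ∎
    where open ≡-Reasoning

  select : Fin (count p) → Fin n
  select = lookup members

  select-sound : ∀ i → p (select i) ≡ true
  select-sound i = Equivalence.to T-≡ (proj₂ (∈-filter⁻ (T? ∘ p) {xs = allFin n} (∈-lookup i)))

  select-injective : ∀ {i j} → select i ≡ select j → i ≡ j
  select-injective = lookup-injective (filter⁺ (T? ∘ p) (allFin⁺ n))

count-mono-injective : ∀ {m n} (p : Fin m → Bool) (q : Fin n → Bool) (f : Fin m → Fin n) →
  (∀ {v} → p v ≡ true → q (f v) ≡ true) →
  (∀ {u v} → p u ≡ true → p v ≡ true → f u ≡ f v → u ≡ v) →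
  count p ≤ℕ count q
count-mono-injective p q f maps injective = injective⇒≤ {f = g} g-injective
  where
  g : Fin (count p) → Fin (count q)
  g i = rank q (f (select p i)) (maps (select-sound p i))
  g-injective : ∀ {i j} → g i ≡ g j → i ≡ j
  g-injective e = select-injective p
    (injective (select-sound p _) (select-sound p _) (rank-injective q _ _ e))

join-injective : ∀ m n {i j : Fin m ⊎ Fin n} → join m n i ≡ join m n j → i ≡ j
join-injective m n {i} {j} e = begin
  i                        ≡⟨ splitAt-join m n i ⟨
  splitAt m (join m n i)   ≡⟨ cong (splitAt m) e ⟩
  splitAt m (join m n j)   ≡⟨ splitAt-join m n j ⟩
  j                        ∎
  where open ≡-Reasoning

+m≤i-+n⇔+[m+n]≤i : ∀ m n i → (+ m ≤ℤ i - + n) ⇔ (+ (m + n) ≤ℤ i)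
+m≤i-+n⇔+[m+n]≤i m n i = mk⇔ to from
  where
  open ≤-Reasoning
  to : + m ≤ℤ i - + n → + (m + n) ≤ℤ i
  to m≤i-n = begin
    + (m + n)          ≡⟨ pos-+ m n ⟩
    + m +ℤ + n         ≤⟨ +-monoˡ-≤ (+ n) m≤i-n ⟩
    (i - + n) +ℤ + n   ≡⟨ //-rightDividesˡ (+ n) i ⟩
    i                  ∎
  from : + (m + n) ≤ℤ i → + m ≤ℤ i - + n
  from m+n≤i = begin
    + m                ≡⟨ //-rightDividesʳ (+ n) (+ m) ⟨
    (+ m +ℤ + n) - + n ≡⟨ cong (_- + n) (pos-+ m n) ⟨
    + (m + n) - + n    ≤⟨ +-monoˡ-≤ (- + n) m+n≤i ⟩
    i - + n            ∎

module _ {V : Set} (G : Graph V) where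

  InN-sym : ∀ {u v} → InN G u v → InN G v u
  InN-sym (inj₁ u≡v) = inj₁ (≡.sym u≡v)
  InN-sym {u} {v} (inj₂ uv) = inj₂ (trans (sym G v u) uv)

  module _ {keep : V → Bool} where

    induced-≡ : {u v : Σ V (T ∘ keep)} → proj₁ u ≡ proj₁ v → u ≡ v
    induced-≡ {u , tu} {_ , tv} refl = cong (u ,_) (T-irrelevant tu tv)

    InN-induced⁺ : ∀ {u v} → InN G (proj₁ u) (proj₁ v) → InN (induced G keep) u v
    InN-induced⁺ (inj₁ u≡v) = inj₁ (induced-≡ u≡v)
    InN-induced⁺ (inj₂ uv)  = inj₂ uv

    InN-induced⁻ : ∀ {u v} → InN (induced G keep) u v → InN G (proj₁ u) (proj₁ v)
    InN-induced⁻ (inj₁ u≡v) = inj₁ (cong proj₁ u≡v)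
    InN-induced⁻ (inj₂ uv)  = inj₂ uv

  record IsUnionOfIsolatedCliques (X : V → Bool) : Set where
    field
      closed : ∀ {u v} → X u ≡ true → InN G u v → X v ≡ true
      twins  : ∀ {u v} → X u ≡ true → adj G u v ≡ true → SameClosedNbhd G u v

  module _ {M : V → Bool} where

    isolated-closed : ∀ {u v} → InIsolatedComponent G M u → InN G u v → InIsolatedComponent G M v
    isolated-closed {u} {v} (Mu , isolated) u~v = isolated u v (here Mu) u~v , isolated′ u~v
      where
      isolated′ : InN G u v → ∀ w x → Reach G M v w → InN G w x → M x ≡ false
      isolated′ (inj₁ refl) = isolated
      isolated′ (inj₂ uv) w x v⇝w = isolated w x (step Mu uv v⇝w)

    isolated-twins : IsTwinCover G M → ∀ {u v} → InIsolatedComponent G M u →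
      adj G u v ≡ true → SameClosedNbhd G u v
    isolated-twins cover {u} {v} (Mu , isolated) uv with cover u v uv
    ... | inj₁ Mu≡true        = contradiction (trans (≡.sym Mu≡true) Mu) λ ()
    ... | inj₂ (inj₁ Mv≡true) = contradiction (trans (≡.sym Mv≡true) (isolated u v (here Mu) (inj₂ uv))) λ ()
    ... | inj₂ (inj₂ twins)   = twins

    isolatedComponents-isUnionOfIsolatedCliques : IsTwinCover G M → {X : V → Bool} →
      (∀ v → (X v ≡ true) ⇔ InIsolatedComponent G M v) → IsUnionOfIsolatedCliques X
    isolatedComponents-isUnionOfIsolatedCliques cover X⇔isolated = record
      { closed = λ Xu u~v → from (isolated-closed (to Xu) u~v)
      ; twins  = λ Xu → isolated-twins cover (to Xu)
      }
      where
      open module X⇔isolated {v} = Equivalence (X⇔isolated v)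

  module _ {k : ℕ} (C : CDColoring G k) where
    open CDColoring C

    restrict : (keep : V → Bool) → (∀ {u v} → T (keep u) → InN G u v → T (keep v)) →
      CDColoring (induced G keep) k
    restrict keep closed = record
      { color     = color ∘ proj₁
      ; proper    = λ u v → proper (proj₁ u) (proj₁ v)
      ; dominated = dominated′
      }
      where
      dominated′ : ∀ i → (∃ λ v → color (proj₁ v) ≡ i) →
        ∃ λ w → ∀ v → color (proj₁ v) ≡ i → InN (induced G keep) w v
      dominated′ i ((u , keep-u) , cu) with dominated i (u , cu)
      ... | w , dom = (w , closed keep-u (InN-sym (dom u cu))) , λ v cv → InN-induced⁺ (dom (proj₁ v) cv)

    compress : (S : Fin k → Bool) → (∀ v → S (color v) ≡ true) → CDColoring G (count S)
    compress S used = record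
      { color     = color′
      ; proper    = λ u v uv e → proper u v uv (rank-injective S _ _ e)
      ; dominated = dominated′
      }
      where
      color′ : V → Fin (count S)
      color′ v = rank S (color v) (used v)
      dominated′ : ∀ i → (∃ λ v → color′ v ≡ i) → ∃ λ w → ∀ v → color′ v ≡ i → InN G w v
      dominated′ i (u , cu) with dominated (color u) (u , refl)
      ... | w , dom = w , λ v cv → dom v (rank-injective S _ _ (trans cv (≡.sym cu)))

    isolated-singleton-class : {X : V → Bool} → IsUnionOfIsolatedCliques X →
      ∀ {u v} → X u ≡ true → color u ≡ color v → u ≡ v
    isolated-singleton-class cliques {u} {v} Xu cu≡cv with dominated (color u) (u , refl)
    ... | w , dom = same-color-neighbour (v∈N[u] (dom u refl))
      where
      open IsUnionOfIsolatedCliques cliques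
      v∈N[u] : InN G w u → InN G u v
      v∈N[u] (inj₁ refl) = dom v (≡.sym cu≡cv)
      v∈N[u] (inj₂ wu)   = Equivalence.from (twins Xu (trans (sym G u w) wu) v) (dom v (≡.sym cu≡cv))
      same-color-neighbour : InN G u v → u ≡ v
      same-color-neighbour (inj₁ u≡v) = u≡v
      same-color-neighbour (inj₂ uv)  = contradiction cu≡cv (proper u v uv)

module _ {n : ℕ} {G : Graph (Fin n)} {X : Fin n → Bool} where

  cdColoring-minus : IsUnionOfIsolatedCliques G X → ∀ {k} → CDColoring G k →
    ∃ λ k′ → k′ + count X ≤ℕ k × CDColoring (G minus X) k′
  cdColoring-minus cliques {k} C =
    count usedOutside , bound , compress (G minus X) restricted usedOutside (used ∘ proj₂)
    where
    open CDColoring C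
    open IsUnionOfIsolatedCliques cliques

    usedOutside? : ∀ i → Dec (∃ λ v → X v ≡ false × color v ≡ i)
    usedOutside? i = any? λ v → (X v ≟ᵇ false) ×-dec (color v ≟ᶠ i)

    usedOutside : Fin k → Bool
    usedOutside = does ∘ usedOutside?

    restricted : CDColoring (G minus X) k
    restricted = restrict G C (not ∘ X) outside-closed
      where
      outside-closed : ∀ {u v} → T (not (X u)) → InN G u v → T (not (X v))
      outside-closed {u} {v} X̸u u~v with X v in Xv
      ... | false = tt
      ... | true  = contradiction (closed Xv (InN-sym G u~v)) λ Xu → ≡.subst (T ∘ not) Xu X̸u

    used : ∀ {v} → T (not (X v)) → usedOutside (color v) ≡ true
    used {v} X̸v = dec-true (usedOutside? _) (v , Equivalence.to T-not-≡ X̸v , refl)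

    unused : ∀ {v} → X v ≡ true → not (usedOutside (color v)) ≡ true
    unused {v} Xv = dec-true (¬? (usedOutside? _)) λ (u , X̸u , cu≡cv) →
      let v≡u = isolated-singleton-class G C cliques Xv (≡.sym cu≡cv) in
      contradiction (trans (≡.sym X̸u) (trans (cong X (≡.sym v≡u)) Xv)) λ ()

    bound : count usedOutside + count X ≤ℕ k
    bound = ≤-trans (+-monoʳ-≤ (count usedOutside)
                      (count-mono-injective X (not ∘ usedOutside) color unused
                        λ Xu _ → isolated-singleton-class G C cliques Xu))
                    (≤-reflexive (count-complement usedOutside))

  cdColoring-plus : ∀ {k} → CDColoring (G minus X) k → CDColoring G (k + count X)
  cdColoring-plus {k} C′ = record
    { color     = color″
    ; proper    = proper″
    ; dominated = λ i (u , cu) → let w , dom = dominator u in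
                    w , λ v cv → dom v (join-injective k (count X) (trans cv (≡.sym cu)))
    }
    where
    open CDColoring C′ renaming (color to color′; proper to proper′; dominated to dominated′)

    outside-or-inside : ∀ v → T (not (X v)) ⊎ X v ≡ true
    outside-or-inside v with X v
    ... | false = inj₁ tt
    ... | true  = inj₂ refl

    side : Fin n → Fin k ⊎ Fin (count X)
    side v = [ (λ X̸v → inj₁ (color′ (v , X̸v))) , (λ Xv → inj₂ (rank X v Xv)) ]′ (outside-or-inside v)

    color″ : Fin n → Fin (k + count X)
    color″ = join k (count X) ∘ side

    proper″ : ∀ u v → adj G u v ≡ true → color″ u ≢ color″ v
    proper″ u v uv e with outside-or-inside u | outside-or-inside v | join-injective k (count X) {side u} {side v} e
    ... | inj₁ X̸u | inj₁ X̸v | e′ = proper′ (u , X̸u) (v , X̸v) uv (inj₁-injective e′)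
    ... | inj₁ _   | inj₂ _  | ()
    ... | inj₂ _   | inj₁ _  | ()
    ... | inj₂ Xu | inj₂ Xv | e′ with rank-injective X Xu Xv (inj₂-injective e′)
    ...   | refl = contradiction (trans (≡.sym uv) (irrefl G u)) λ ()

    dominator : ∀ u → ∃ λ w → ∀ v → side v ≡ side u → InN G w v
    dominator u with outside-or-inside u
    ... | inj₂ Xu = u , class-member
      where
      class-member : ∀ v → side v ≡ inj₂ (rank X u Xu) → InN G u v
      class-member v e with outside-or-inside v
      ... | inj₂ Xv = inj₁ (≡.sym (rank-injective X Xv Xu (inj₂-injective e)))
      ... | inj₁ _ with () ← e
    ... | inj₁ X̸u with dominated′ (color′ (u , X̸u)) ((u , X̸u) , refl)
    ...   | (w , _) , dom = w , class-member
      where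
      class-member : ∀ v → side v ≡ inj₁ (color′ (u , X̸u)) → InN G w v
      class-member v e with outside-or-inside v
      ... | inj₁ X̸v = InN-induced⁻ G (dom (v , X̸v) (inj₁-injective e))
      ... | inj₂ _ with () ← e

corollary3 : (n : ℕ) (G : Graph (Fin n)) (M : Fin n → Bool) → IsTwinCover G M →
    (X : Fin n → Bool) → (∀ v → (X v ≡ true) ⇔ InIsolatedComponent G M v) →
    (ℓ : ℤ) → YesCDC G ℓ ⇔ YesCDC (G minus X) (ℓ - + count X)
corollary3 n G M cover X X⇔isolated ℓ = mk⇔ to from
  where
  cliques : IsUnionOfIsolatedCliques G X
  cliques = isolatedComponents-isUnionOfIsolatedCliques G cover X⇔isolated

  to : YesCDC G ℓ → YesCDC (G minus X) (ℓ - + count X)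
  to (k , k≤ℓ , C) with cdColoring-minus cliques C
  ... | k′ , k′+|X|≤k , C′ =
    k′ , Equivalence.from (+m≤i-+n⇔+[m+n]≤i k′ (count X) ℓ) (≤ℤ-trans (+≤+ k′+|X|≤k) k≤ℓ) , C′

  from : YesCDC (G minus X) (ℓ - + count X) → YesCDC G ℓ
  from (k′ , k′≤ℓ-|X| , C′) =
    k′ + count X , Equivalence.to (+m≤i-+n⇔+[m+n]≤i k′ (count X) ℓ) k′≤ℓ-|X| , cdColoring-plus C′
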